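{- Let $O$ be a $\lambda$-term with $x\notin FV(O)$, and let $\mathcal{T}$ be any $\lambda$-theory containing the equations $\Theta x O = x$ and $\Theta xx = O$. Then $\mathcal{T}\vdash O = Y(\lambda x.x)$ for every fixpoint combinator $Y$. In particular, if $Y \equiv \lambda f.(\lambda x.f(xx))(\lambda x.f(xx))$ is Curry's fixpoint combinator, then $\mathcal{T}\vdash O = \Omega$.
   Context: A $\lambda$-theory is a congruence on $\lambda$-terms (w.r.t. application and abstraction) containing $\alpha\beta$-conversion. A fixpoint combinator is a closed term $Y$ with $YM =_\beta M(YM)$ for all terms $M$. $\Omega \equiv (\lambda x.xx)(\lambda x.xx)$, $B \equiv \lambda x.x(\lambda y.yx)$, $C \equiv \lambda z.zB$, $\Theta \equiv BC$. -}

module Defs where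

open import Data.Nat using (ℕ; zero; suc)
open import Data.Empty using (⊥)
open import Relation.Binary.Core using (Rel)
open import Relation.Binary.Structures using (IsEquivalence)
open import Level using (0ℓ)

-- Untyped λ-terms in de Bruijn notation (α-equivalence is built in).
-- Free variables are the indices that point past all enclosing binders.
infixl 7 _·_
data Term : Set where
  var : ℕ → Term
  _·_ : Term → Term → Term
  ƛ_  : Term → Term

ext : (ℕ → ℕ) → ℕ → ℕ
ext ρ zero    = zero
ext ρ (suc n) = suc (ρ n)

rename : (ℕ → ℕ) → Term → Term
rename ρ (var n) = var (ρ n)
rename ρ (t · u) = rename ρ t · rename ρ u
rename ρ (ƛ t)   = ƛ rename (ext ρ) t

exts : (ℕ → Term) → ℕ → Term
exts σ zero    = var zero
exts σ (suc n) = rename suc (σ n)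

subst : (ℕ → Term) → Term → Term
subst σ (var n) = σ n
subst σ (t · u) = subst σ t · subst σ u
subst σ (ƛ t)   = ƛ subst (exts σ) t

-- the substitution [0 := s], decrementing the other free indices
single : Term → ℕ → Term
single s zero    = s
single s (suc n) = var n

_[_] : Term → Term → Term
t [ s ] = subst (single s) t

data _∈FV_ : ℕ → Term → Set where
  fv-var : ∀ {n} → n ∈FV var n
  fv-appˡ : ∀ {n t u} → n ∈FV t → n ∈FV (t · u)
  fv-appʳ : ∀ {n t u} → n ∈FV u → n ∈FV (t · u)
  fv-lam : ∀ {n t} → suc n ∈FV t → n ∈FV (ƛ t)

Closed : Term → Set
Closed t = ∀ n → n ∈FV t → ⊥

record IsLambdaTheory (_≈_ : Rel Term 0ℓ) : Set where
  field
    isEquivalence : IsEquivalence _≈_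
    app-cong : ∀ {t t′ u u′} → t ≈ t′ → u ≈ u′ → (t · u) ≈ (t′ · u′)
    lam-cong : ∀ {t t′} → t ≈ t′ → (ƛ t) ≈ (ƛ t′)
    beta     : ∀ t s → ((ƛ t) · s) ≈ (t [ s ])

infix 4 _=β_
data _=β_ : Term → Term → Set where
  β-refl  : ∀ {t} → t =β t
  β-sym   : ∀ {t u} → t =β u → u =β t
  β-trans : ∀ {t u v} → t =β u → u =β v → t =β v
  β-app   : ∀ {t t′ u u′} → t =β t′ → u =β u′ → (t · u) =β (t′ · u′)
  β-lam   : ∀ {t t′} → t =β t′ → (ƛ t) =β (ƛ t′)
  β-β     : ∀ t s → ((ƛ t) · s) =β (t [ s ])

record IsFixpointCombinator (Y : Term) : Set where
  field
    closed : Closed Y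
    fix    : ∀ M → (Y · M) =β (M · (Y · M))

I : Term
I = ƛ var 0

Ω : Term                       -- (λx.xx)(λx.xx)
Ω = (ƛ (var 0 · var 0)) · (ƛ (var 0 · var 0))

B : Term                       -- λx.x(λy.yx)
B = ƛ (var 0 · (ƛ (var 0 · var 1)))

C : Term                       -- λz.zB
C = ƛ (var 0 · B)

Θ : Term
Θ = B · C

Ycurry : Term                  -- λf.(λx.f(xx))(λx.f(xx))
Ycurry = ƛ ((ƛ (var 1 · (var 0 · var 0))) · (ƛ (var 1 · (var 0 · var 0))))

module Submission where

-- A λ-theory is closed under substitution, so the two hypotheses hold with
-- x replaced by an arbitrary term M:
--   (absorption)  Θ M O = M          (diagonal)  Θ M M = O.
-- Fix a fixpoint combinator Y and put G ≡ λn z. Θ z n. The closed term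
-- N ≡ W W with W ≡ λw. Y (G (w w)) satisfies N = Y (G N), hence
--   N = Y (G N) = G N (Y (G N)) = Θ (Y (G N)) N = Θ N N = O,
-- and then G N = λz. Θ z N = λz. Θ z O = λz. z = I, so O = N = Y (G N) = Y I.
-- Curry's combinator is a fixpoint combinator with Y I =β Ω.

open import Defs
open import Data.Nat using (ℕ; zero; suc; _≤_; _<_; _+_; _⊔_; _∸_; _≟_; _<?_; pred)
open import Data.Nat.Properties using (m+n≮m; m+n∸m≡n; <-≤-trans; ≤-refl; m≤m⊔n; m≤n⊔m; suc[m]≤n⇒m≤pred[n]; n≮0; ≤-reflexive)
open import Data.Product using (_×_; _,_)
open import Data.Empty using (⊥-elim)
open import Relation.Nullary using (¬_; yes; no)
open import Relation.Binary.Core using (Rel)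
open import Relation.Binary.Bundles using (Setoid)
open import Relation.Binary.PropositionalEquality using (_≡_; _≢_; refl; cong; cong₂; sym; trans)
open import Level using (0ℓ)
open import Function using (_∘_)

rename-ext : ∀ {ρ ρ′} → (∀ n → ρ n ≡ ρ′ n) → ∀ t → rename ρ t ≡ rename ρ′ t
rename-ext h (var n) = cong var (h n)
rename-ext h (t · u) = cong₂ _·_ (rename-ext h t) (rename-ext h u)
rename-ext {ρ} {ρ′} h (ƛ t) = cong ƛ_ (rename-ext ext-h t)
  where
  ext-h : ∀ n → ext ρ n ≡ ext ρ′ n
  ext-h zero    = refl
  ext-h (suc n) = cong suc (h n)

rename-fixes : ∀ ρ t → (∀ n → n ∈FV t → ρ n ≡ n) → rename ρ t ≡ t
rename-fixes ρ (var n) h = cong var (h n fv-var)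
rename-fixes ρ (t · u) h =
  cong₂ _·_ (rename-fixes ρ t (λ n → h n ∘ fv-appˡ)) (rename-fixes ρ u (λ n → h n ∘ fv-appʳ))
rename-fixes ρ (ƛ t) h = cong ƛ_ (rename-fixes (ext ρ) t ext-h)
  where
  ext-h : ∀ n → n ∈FV t → ext ρ n ≡ n
  ext-h zero    _ = refl
  ext-h (suc n) p = cong suc (h n (fv-lam p))

subst-agree : ∀ {σ τ} t → (∀ n → n ∈FV t → σ n ≡ τ n) → subst σ t ≡ subst τ t
subst-agree (var n) h = h n fv-var
subst-agree (t · u) h =
  cong₂ _·_ (subst-agree t (λ n → h n ∘ fv-appˡ)) (subst-agree u (λ n → h n ∘ fv-appʳ))
subst-agree {σ} {τ} (ƛ t) h = cong ƛ_ (subst-agree t exts-h)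
  where
  exts-h : ∀ n → n ∈FV t → exts σ n ≡ exts τ n
  exts-h zero    _ = refl
  exts-h (suc n) p = cong (rename suc) (h n (fv-lam p))

subst-ext : ∀ {σ τ} → (∀ n → σ n ≡ τ n) → ∀ t → subst σ t ≡ subst τ t
subst-ext h t = subst-agree t (λ n _ → h n)

subst-var : ∀ t → subst var t ≡ t
subst-var (var n) = refl
subst-var (t · u) = cong₂ _·_ (subst-var t) (subst-var u)
subst-var (ƛ t)   = cong ƛ_ (trans (subst-ext exts-var t) (subst-var t))
  where
  exts-var : ∀ n → exts var n ≡ var n
  exts-var zero    = refl
  exts-var (suc n) = refl

subst-fixes : ∀ σ t → (∀ n → n ∈FV t → σ n ≡ var n) → subst σ t ≡ t
subst-fixes σ t h = trans (subst-agree t h) (subst-var t)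

rename-rename : ∀ ρ ρ′ t → rename ρ (rename ρ′ t) ≡ rename (ρ ∘ ρ′) t
rename-rename ρ ρ′ (var n) = refl
rename-rename ρ ρ′ (t · u) = cong₂ _·_ (rename-rename ρ ρ′ t) (rename-rename ρ ρ′ u)
rename-rename ρ ρ′ (ƛ t)   =
  cong ƛ_ (trans (rename-rename (ext ρ) (ext ρ′) t) (rename-ext ext-∘ t))
  where
  ext-∘ : ∀ n → ext ρ (ext ρ′ n) ≡ ext (ρ ∘ ρ′) n
  ext-∘ zero    = refl
  ext-∘ (suc n) = refl

subst-rename : ∀ σ ρ t → subst σ (rename ρ t) ≡ subst (σ ∘ ρ) t
subst-rename σ ρ (var n) = refl
subst-rename σ ρ (t · u) = cong₂ _·_ (subst-rename σ ρ t) (subst-rename σ ρ u)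
subst-rename σ ρ (ƛ t)   =
  cong ƛ_ (trans (subst-rename (exts σ) (ext ρ) t) (subst-ext exts-∘ t))
  where
  exts-∘ : ∀ n → exts σ (ext ρ n) ≡ exts (σ ∘ ρ) n
  exts-∘ zero    = refl
  exts-∘ (suc n) = refl

rename-subst : ∀ ρ σ t → rename ρ (subst σ t) ≡ subst (rename ρ ∘ σ) t
rename-subst ρ σ (var n) = refl
rename-subst ρ σ (t · u) = cong₂ _·_ (rename-subst ρ σ t) (rename-subst ρ σ u)
rename-subst ρ σ (ƛ t)   =
  cong ƛ_ (trans (rename-subst (ext ρ) (exts σ) t) (subst-ext ext-exts t))
  where
  ext-exts : ∀ n → rename (ext ρ) (exts σ n) ≡ exts (rename ρ ∘ σ) n
  ext-exts zero    = refl
  ext-exts (suc n) = trans (rename-rename (ext ρ) suc (σ n)) (sym (rename-rename suc ρ (σ n)))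

subst-subst : ∀ σ τ t → subst σ (subst τ t) ≡ subst (subst σ ∘ τ) t
subst-subst σ τ (var n) = refl
subst-subst σ τ (t · u) = cong₂ _·_ (subst-subst σ τ t) (subst-subst σ τ u)
subst-subst σ τ (ƛ t)   =
  cong ƛ_ (trans (subst-subst (exts σ) (exts τ) t) (subst-ext exts-exts t))
  where
  exts-exts : ∀ n → subst (exts σ) (exts τ n) ≡ exts (subst σ ∘ τ) n
  exts-exts zero    = refl
  exts-exts (suc n) = trans (subst-rename (exts σ) suc (τ n)) (sym (rename-subst suc σ (τ n)))

weaken-instantiate : ∀ s t → subst (single s) (rename suc t) ≡ t
weaken-instantiate s t = trans (subst-rename (single s) suc t) (subst-var t)

-- A substitution σ factors as: substitute its tail under a binder, then σ 0.
-- This is what lets σ be realised by abstraction followed by β-reduction.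
subst-peel : ∀ σ t → subst (single (σ 0)) (subst (exts (σ ∘ suc)) t) ≡ subst σ t
subst-peel σ t = trans (subst-subst (single (σ 0)) (exts (σ ∘ suc)) t) (subst-ext peel t)
  where
  peel : ∀ n → subst (single (σ 0)) (exts (σ ∘ suc) n) ≡ σ n
  peel zero    = refl
  peel (suc n) = weaken-instantiate (σ 0) (σ (suc n))

closed-subst : ∀ σ t → Closed t → subst σ t ≡ t
closed-subst σ t c = subst-fixes σ t (λ n p → ⊥-elim (c n p))

closed-rename : ∀ ρ t → Closed t → rename ρ t ≡ t
closed-rename ρ t c = rename-fixes ρ t (λ n p → ⊥-elim (c n p))

closed-app : ∀ {t u} → Closed t → Closed u → Closed (t · u)
closed-app ct cu n (fv-appˡ p) = ct n p
closed-app ct cu n (fv-appʳ p) = cu n p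

-- A strict upper bound on the free variables of a term; it makes finitely
-- many variables relevant, and decides closedness of concrete terms.
bound : Term → ℕ
bound (var n) = suc n
bound (t · u) = bound t ⊔ bound u
bound (ƛ t)   = pred (bound t)

fv-bound : ∀ {n t} → n ∈FV t → n < bound t
fv-bound fv-var = ≤-refl
fv-bound {t = t · u} (fv-appˡ p) = <-≤-trans (fv-bound p) (m≤m⊔n (bound t) (bound u))
fv-bound {t = t · u} (fv-appʳ p) = <-≤-trans (fv-bound p) (m≤n⊔m (bound t) (bound u))
fv-bound (fv-lam p) = suc[m]≤n⇒m≤pred[n] (fv-bound p)

bound-zero-closed : ∀ t → bound t ≡ 0 → Closed t
bound-zero-closed t b≡0 n p = n≮0 (<-≤-trans (fv-bound p) (≤-reflexive b≡0))

cutoff : ℕ → (ℕ → Term) → ℕ → Term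
cutoff k σ n with n <? k
... | yes _ = σ n
... | no _  = var (n ∸ k)

cutoff-low : ∀ k σ {n} → n < k → cutoff k σ n ≡ σ n
cutoff-low k σ {n} n<k with n <? k
... | yes _   = refl
... | no n≮k = ⊥-elim (n≮k n<k)

cutoff-high : ∀ k σ n → cutoff k σ (k + n) ≡ var n
cutoff-high k σ n with k + n <? k
... | yes k+n<k = ⊥-elim (m+n≮m k n k+n<k)
... | no _      = cong var (m+n∸m≡n k n)

_≔_ : ℕ → Term → ℕ → Term
(x ≔ M) n with n ≟ x
... | yes _ = M
... | no _  = var n

≔-here : ∀ x M → (x ≔ M) x ≡ M
≔-here x M with x ≟ x
... | yes _  = refl
... | no x≢x = ⊥-elim (x≢x refl)

≔-elsewhere : ∀ x M {n} → n ≢ x → (x ≔ M) n ≡ var n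
≔-elsewhere x M {n} n≢x with n ≟ x
... | yes n≡x = ⊥-elim (n≢x n≡x)
... | no _    = refl

≔-fresh : ∀ x M t → ¬ (x ∈FV t) → subst (x ≔ M) t ≡ t
≔-fresh x M t x∉t = subst-fixes (x ≔ M) t fresh
  where
  fresh : ∀ n → n ∈FV t → (x ≔ M) n ≡ var n
  fresh n n∈t = ≔-elsewhere x M (λ { refl → x∉t n∈t })

-- G ≡ λn z. Θ z n : abstracts the second argument of Θ first.
G : Term
G = ƛ ƛ (Θ · var 0 · var 1)

closed-G : Closed G
closed-G = bound-zero-closed G refl

-- W ≡ λw. Y (F (w w)); the self-application W W is a fixed point of Y ∘ F.
selfApplicand : Term → Term → Term
selfApplicand Y F = ƛ (Y · (F · (var 0 · var 0)))

closed-selfApplicand : ∀ {Y F} → Closed Y → Closed F → Closed (selfApplicand Y F)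
closed-selfApplicand cY cF n (fv-lam (fv-appˡ p))                   = cY (suc n) p
closed-selfApplicand cY cF n (fv-lam (fv-appʳ (fv-appˡ p)))          = cF (suc n) p
closed-selfApplicand cY cF n (fv-lam (fv-appʳ (fv-appʳ (fv-appˡ ()))))
closed-selfApplicand cY cF n (fv-lam (fv-appʳ (fv-appʳ (fv-appʳ ()))))

=β-isLambdaTheory : IsLambdaTheory _=β_
=β-isLambdaTheory = record
  { isEquivalence = record { refl = β-refl ; sym = β-sym ; trans = β-trans }
  ; app-cong      = β-app
  ; lam-cong      = β-lam
  ; beta          = β-β
  }

module LambdaTheory (_≈_ : Rel Term 0ℓ) (L : IsLambdaTheory _≈_) where
  open IsLambdaTheory L

  setoid : Setoid 0ℓ 0ℓ
  setoid = record { isEquivalence = isEquivalence }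

  open Setoid setoid public using (reflexive) renaming (refl to ≈-refl; sym to ≈-sym; trans to ≈-trans)
  open import Relation.Binary.Reasoning.Setoid setoid

  β⇒≈ : ∀ {t u} → t =β u → t ≈ u
  β⇒≈ β-refl        = ≈-refl
  β⇒≈ (β-sym p)     = ≈-sym (β⇒≈ p)
  β⇒≈ (β-trans p q) = ≈-trans (β⇒≈ p) (β⇒≈ q)
  β⇒≈ (β-app p q)   = app-cong (β⇒≈ p) (β⇒≈ q)
  β⇒≈ (β-lam p)     = lam-cong (β⇒≈ p)
  β⇒≈ (β-β t s)     = beta t s

  -- Closure under a substitution that maps k + n to n: abstract the first k
  -- variables one at a time and β-reduce against σ 0, …, σ (k-1).
  subst-≈-shifting : ∀ k {t u} → t ≈ u → ∀ σ → (∀ n → σ (k + n) ≡ var n) →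
                     subst σ t ≈ subst σ u
  subst-≈-shifting zero {t} {u} t≈u σ σ≡var = begin
    subst σ t  ≡⟨ subst-fixes σ t (λ n _ → σ≡var n) ⟩
    t          ≈⟨ t≈u ⟩
    u          ≡⟨ subst-fixes σ u (λ n _ → σ≡var n) ⟨
    subst σ u  ∎
  subst-≈-shifting (suc k) {t} {u} t≈u σ σ-shift = begin
    subst σ t                               ≡⟨ subst-peel σ t ⟨
    subst (single (σ 0)) (subst (exts σ′) t) ≈⟨ beta _ (σ 0) ⟨
    subst σ′ (ƛ t) · σ 0                    ≈⟨ app-cong under-binder ≈-refl ⟩
    subst σ′ (ƛ u) · σ 0                    ≈⟨ beta _ (σ 0) ⟩
    subst (single (σ 0)) (subst (exts σ′) u) ≡⟨ subst-peel σ u ⟩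
    subst σ u                               ∎
    where
    σ′ : ℕ → Term
    σ′ = σ ∘ suc
    under-binder : subst σ′ (ƛ t) ≈ subst σ′ (ƛ u)
    under-binder = subst-≈-shifting k (lam-cong t≈u) σ′ σ-shift

  -- Every λ-theory is closed under arbitrary substitutions: only the free
  -- variables below k matter, and cutoff k σ is of the shifting form above.
  subst-≈ : ∀ {t u} → t ≈ u → ∀ σ → subst σ t ≈ subst σ u
  subst-≈ {t} {u} t≈u σ = begin
    subst σ t           ≡⟨ subst-agree t (λ n p → cutoff-low k σ (below-k t n p (m≤m⊔n _ _))) ⟨
    subst (cutoff k σ) t ≈⟨ subst-≈-shifting k t≈u (cutoff k σ) (cutoff-high k σ) ⟩
    subst (cutoff k σ) u ≡⟨ subst-agree u (λ n p → cutoff-low k σ (below-k u n p (m≤n⊔m _ _))) ⟩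
    subst σ u           ∎
    where
    k : ℕ
    k = bound t ⊔ bound u
    below-k : ∀ s n → n ∈FV s → bound s ≤ k → n < k
    below-k s n p b≤k = <-≤-trans (fv-bound p) b≤k

  absorption : ∀ O x → ¬ (x ∈FV O) → (Θ · var x · O) ≈ var x → ∀ M → (Θ · M · O) ≈ M
  absorption O x x∉O hyp M = begin
    Θ · M · O                       ≡⟨ cong₂ (λ a b → Θ · a · b) (≔-here x M) (≔-fresh x M O x∉O) ⟨
    subst (x ≔ M) (Θ · var x · O)   ≈⟨ subst-≈ hyp (x ≔ M) ⟩
    (x ≔ M) x                       ≡⟨ ≔-here x M ⟩
    M                               ∎

  diagonal : ∀ O x → ¬ (x ∈FV O) → (Θ · var x · var x) ≈ O → ∀ M → (Θ · M · M) ≈ O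
  diagonal O x x∉O hyp M = begin
    Θ · M · M                           ≡⟨ cong (λ a → Θ · a · a) (≔-here x M) ⟨
    subst (x ≔ M) (Θ · var x · var x)   ≈⟨ subst-≈ hyp (x ≔ M) ⟩
    subst (x ≔ M) O                     ≡⟨ ≔-fresh x M O x∉O ⟩
    O                                   ∎

  G-β : ∀ N M → (G · N · M) ≈ (Θ · M · N)
  G-β N M = begin
    G · N · M                             ≈⟨ app-cong (beta _ N) ≈-refl ⟩
    ƛ (Θ · var 0 · rename suc N) · M      ≈⟨ beta _ M ⟩
    Θ · M · subst (single M) (rename suc N) ≡⟨ cong (Θ · M ·_) (weaken-instantiate M N) ⟩
    Θ · M · N                             ∎

  selfApplication-unfolds : ∀ Y F → Closed Y → Closed F →
    let N = selfApplicand Y F · selfApplicand Y F in N ≈ (Y · (F · N))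
  selfApplication-unfolds Y F cY cF = ≈-trans (beta _ W)
    (reflexive (cong₂ (λ a b → a · (b · (W · W))) (closed-subst (single W) Y cY)
                                                  (closed-subst (single W) F cF)))
    where
    W : Term
    W = selfApplicand Y F

  fixpoint-of-identity : ∀ O → (∀ M → (Θ · M · O) ≈ M) → (∀ M → (Θ · M · M) ≈ O) →
                         ∀ Y → IsFixpointCombinator Y → O ≈ (Y · I)
  fixpoint-of-identity O absorb diag Y fp = begin
    O              ≈⟨ N≈O ⟨
    N              ≈⟨ N-unfolds ⟩
    Y · (G · N)    ≈⟨ app-cong ≈-refl GN≈I ⟩
    Y · I          ∎
    where
    open IsFixpointCombinator fp renaming (closed to closed-Y)
    W N : Term
    W = selfApplicand Y G
    N = W · W
    closed-N : Closed N
    closed-N = closed-app (closed-selfApplicand closed-Y closed-G) (closed-selfApplicand closed-Y closed-G)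
    N-unfolds : N ≈ (Y · (G · N))
    N-unfolds = selfApplication-unfolds Y G closed-Y closed-G
    N≈O : N ≈ O
    N≈O = begin
      N                      ≈⟨ N-unfolds ⟩
      Y · (G · N)            ≈⟨ β⇒≈ (fix (G · N)) ⟩
      G · N · (Y · (G · N))  ≈⟨ G-β N (Y · (G · N)) ⟩
      Θ · (Y · (G · N)) · N  ≈⟨ app-cong (app-cong ≈-refl N-unfolds) ≈-refl ⟨
      Θ · N · N              ≈⟨ diag N ⟩
      O                      ∎
    GN≈I : (G · N) ≈ I
    GN≈I = begin
      G · N                         ≈⟨ beta _ N ⟩
      ƛ (Θ · var 0 · rename suc N)  ≡⟨ cong (λ a → ƛ (Θ · var 0 · a)) (closed-rename suc N closed-N) ⟩
      ƛ (Θ · var 0 · N)             ≈⟨ lam-cong (app-cong ≈-refl N≈O) ⟩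
      ƛ (Θ · var 0 · O)             ≈⟨ lam-cong (absorb (var 0)) ⟩
      I                             ∎

  Ycurry-unfolds : ∀ M → (Ycurry · M) ≈ (M · (Ycurry · M))
  Ycurry-unfolds M = begin
    Ycurry · M      ≈⟨ beta _ M ⟩
    X · X           ≈⟨ beta _ X ⟩
    subst (single X) (rename suc M) · (X · X)  ≡⟨ cong (_· (X · X)) (weaken-instantiate X M) ⟩
    M · (X · X)     ≈⟨ app-cong ≈-refl (beta _ M) ⟨
    M · (Ycurry · M) ∎
    where
    X : Term
    X = ƛ (rename suc M · (var 0 · var 0))

  Ycurry-I : (Ycurry · I) ≈ Ω
  Ycurry-I = ≈-trans (beta _ I) (app-cong (lam-cong (beta _ _)) (lam-cong (beta _ _)))

Ycurry-isFixpointCombinator : IsFixpointCombinator Ycurry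
Ycurry-isFixpointCombinator = record
  { closed = bound-zero-closed Ycurry refl
  ; fix    = LambdaTheory.Ycurry-unfolds _=β_ =β-isLambdaTheory
  }

theorem2p3 : (O : Term) (x : ℕ) → ¬ (x ∈FV O) →
    (_≈_ : Rel Term 0ℓ) → IsLambdaTheory _≈_ →
    (Θ · var x · O) ≈ var x → (Θ · var x · var x) ≈ O →
    ((Y : Term) → IsFixpointCombinator Y → O ≈ (Y · I)) × (O ≈ Ω)
theorem2p3 O x x∉O _≈_ L absorb-x diag-x = O≈YI , O≈Ω
  where
  open LambdaTheory _≈_ L
  O≈YI : (Y : Term) → IsFixpointCombinator Y → O ≈ (Y · I)
  O≈YI = fixpoint-of-identity O (absorption O x x∉O absorb-x) (diagonal O x x∉O diag-x)
  O≈Ω : O ≈ Ω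
  O≈Ω = ≈-trans (O≈YI Ycurry Ycurry-isFixpointCombinator) Ycurry-I
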